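{- In a model of dependent type theory with dependent product types, dependent sum types, extensional identity types, unit type, disjoint finite coproducts and propositional truncation, any universe $\mathcal U$ satisfies the isomorphism extension axiom with $\mathrm{Cof}=\mathbf 2$: there is an operation assigning to $\varphi:\mathbf 2$, $A:\varphi\to\mathcal U$, $B:\mathcal U$ and $f:\prod_{u:\varphi}Au\cong B$ a pair $(\bar A,\bar f)$ with $\bar A:\mathcal U$ and $\bar f:\bar A\cong B$ such that $\forall_{u:\varphi}(Au,fu)=(\bar A,\bar f)$.
   Context: We use the internal language of the model. A universe is a closed type $\mathcal U$ with a type family $\mathrm{el}$ over it (we write $A$ for $\mathrm{el}(A)$, so $Au\cong B$ means an isomorphism $\mathrm{el}(Au)\cong\mathrm{el}(B)$). $\mathbf 2:=\mathbf1+\mathbf1$ with elements $0,1$; it is regarded as a propositional universe by identifying $b:\mathbf 2$ with the proposition $b=1$, and it classifies decidable propositions. -}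

module Defs where

open import Level using (Level; _⊔_)
open import Data.Bool using (Bool; true)
open import Data.Product using (Σ; _,_)
open import Function.Bundles using (_↔_)
open import Relation.Binary.PropositionalEquality using (_≡_)

-- Cof = 2: a cofibration φ : Bool is read as the proposition φ ≡ true.
IsoExtension₂ : ∀ {a ℓ} (U : Set a) (el : U → Set ℓ) → Set (a ⊔ ℓ)
IsoExtension₂ U el =
  (φ : Bool) (A : φ ≡ true → U) (B : U) (f : (u : φ ≡ true) → el (A u) ↔ el B) →
  Σ (Σ U (λ Ā → el Ā ↔ el B)) (λ p → (u : φ ≡ true) → (A u , f u) ≡ p)

module Submission where

-- A cofibration φ : 2 is the proposition φ ≡ true, which is decidable, so
-- the extension problem splits on φ:
--   * if φ is false, the partial isomorphism has empty domain and any pair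
--     extends it; we take (B , id);
--   * if φ is true, we take the pair at the canonical proof refl; it agrees
--     with the pair at every other proof u because φ ≡ true is a
--     proposition (Bool has decidable equality, hence UIP).

open import Defs
open import Level using (Level)
open import Data.Bool using (Bool; true; false)
open import Data.Bool.Properties using (_≟_)
open import Data.Empty using (⊥-elim)
open import Data.Product using (Σ; _,_)
open import Function.Bundles using (_↔_)
open import Function.Properties.Inverse using (↔-refl)
open import Relation.Binary.PropositionalEquality using (_≡_; refl; cong)
open import Relation.Nullary using (¬_)
open import Axiom.UniquenessOfIdentityProofs using (module Decidable⇒UIP)

private
  variable
    p q : Level

extend-refuted : {X : Set p} {T : Set q} (t : X → T) → ¬ X → (t̄ : T) →
                 Σ T (λ s → (u : X) → t u ≡ s)
extend-refuted t ¬x t̄ = t̄ , λ u → ⊥-elim (¬x u)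

extend-inhabited : {X : Set p} {T : Set q} (t : X → T) →
                   ((u v : X) → u ≡ v) → X →
                   Σ T (λ s → (u : X) → t u ≡ s)
extend-inhabited t irr x = t x , λ u → cong t (irr u x)

cofibration-irrelevant : (φ : Bool) (u v : φ ≡ true) → u ≡ v
cofibration-irrelevant φ = Decidable⇒UIP.≡-irrelevant _≟_

proposition4p6 : ∀ {a ℓ} (U : Set a) (el : U → Set ℓ) → IsoExtension₂ U el
proposition4p6 U el false A B f =
  extend-refuted (λ u → A u , f u) (λ ()) (B , ↔-refl)
proposition4p6 U el true A B f =
  extend-inhabited (λ u → A u , f u) (cofibration-irrelevant true) refl
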